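{- $\sigma(C_4+P_k)=1$ for all $k\ge 3$.
   Context: A graph $H=(V,E)$ is a sum graph if there is an injective map $\lambda:V\to\mathbb{N}$ with $E=\{xy : \exists z\in V,\ \lambda(z)=\lambda(x)+\lambda(y)\}$. For a graph $G$ without isolated vertices, $\sigma(G)$ is the minimum $k$ such that $G+N_k$ is a sum graph ($N_k$: $k$ isolated vertices, $+$: disjoint union). $C_4$ is the 4-cycle and $P_k$ is the path on $k$ vertices. -}

module Defs where

open import Data.Nat using (ℕ; zero; suc; _+_; _∸_; _<_)
open import Agda.Builtin.Nat using (_==_)
open import Data.Bool using (Bool; true; false; _∨_; _∧_)
open import Data.Fin using (Fin; toℕ; splitAt)
open import Data.Sum using (_⊎_; inj₁; inj₂)
open import Data.Product using (Σ; ∃; _×_)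
open import Function.Bundles using (_⇔_)
open import Function.Definitions using (Injective)
open import Relation.Binary.PropositionalEquality using (_≡_; _≢_)
open import Relation.Nullary using (¬_)

-- A finite simple graph on vertex set Fin order, with Boolean adjacency.
-- (Only pairs of distinct vertices are relevant.)
record Graph : Set where
  field
    order : ℕ
    adj   : Fin order → Fin order → Bool
open Graph public

Edge : (G : Graph) → Fin (order G) → Fin (order G) → Set
Edge G x y = adj G x y ≡ true

P : ℕ → Graph
P k = record { order = k
             ; adj = λ i j → (suc (toℕ i) == toℕ j) ∨ (suc (toℕ j) == toℕ i) }

C : ℕ → Graph
C n = record { order = n
             ; adj = λ i j → (suc (toℕ i) == toℕ j) ∨ (suc (toℕ j) == toℕ i)
                           ∨ ((toℕ i == 0) ∧ (toℕ j == n ∸ 1))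
                           ∨ ((toℕ j == 0) ∧ (toℕ i == n ∸ 1)) }

N : ℕ → Graph
N k = record { order = k ; adj = λ _ _ → false }

_⊕_ : Graph → Graph → Graph
G ⊕ H = record { order = order G + order H ; adj = a }
  where
  a : Fin (order G + order H) → Fin (order G + order H) → Bool
  a x y with splitAt (order G) x | splitAt (order G) y
  ... | inj₁ i | inj₁ j = adj G i j
  ... | inj₂ i | inj₂ j = adj H i j
  ... | _      | _      = false

infixl 6 _⊕_

IsSumLabelling : (G : Graph) → (Fin (order G) → ℕ) → Set
IsSumLabelling G ℓ =
  Injective _≡_ _≡_ ℓ
  × (∀ x → 0 < ℓ x)
  × (∀ x y → x ≢ y → (Edge G x y ⇔ (∃ λ z → ℓ z ≡ ℓ x + ℓ y)))

IsSumGraph : Graph → Set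
IsSumGraph G = ∃ λ (ℓ : Fin (order G) → ℕ) → IsSumLabelling G ℓ

SumNumber : Graph → ℕ → Set
SumNumber G k = IsSumGraph (G ⊕ N k) × (∀ j → j < k → ¬ IsSumGraph (G ⊕ N j))

module Submission where

-- A sum graph always has an isolated vertex: a vertex x of maximal label has no neighbour y,
-- since λ(x) + λ(y) would be a larger label. C₄ + Pₖ has no isolated vertex, so σ ≥ 1.
-- For σ ≤ 1, label the cycle 1, 3, 9, 11, the path 12, 4, 16, 20, 36, 56, … (from the third
-- label on, each is the sum of the previous two) and the added isolated vertex by the next
-- term. The cycle edges have sums 4, 12, 20, 12 and each path edge sums to a later path label.
-- Sorted, the labels form u = 1, 3, 4, 9, 11, 12, 16, 20, 36, … with u (n + 2) = u n + u (n + 1)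
-- for n ≥ 6, so for a < n the sum u a + u (n + 1) lies strictly between u (n + 1) and u (n + 2).
-- This, and a direct check of the few small sums, shows that no other pair sums to a label;
-- sums with the isolated vertex exceed the largest label.

open import Data.Bool using (true; false; T; _∨_)
open import Data.Bool.Properties using (T-≡; T-∨)
open import Data.Empty using (⊥-elim)
import Data.Fin as Fin
open import Data.Fin using (Fin; toℕ; fromℕ<; _↑ˡ_; _↑ʳ_)
open import Data.Fin.Patterns using (0F; 1F; 2F; 3F)
open import Data.Fin.Properties
  using (toℕ<n; toℕ-fromℕ<; toℕ-injective; toℕ-↑ˡ; toℕ-↑ʳ; splitAt-↑ˡ; splitAt-↑ʳ; ↑ˡ-injective; ↑ʳ-injective)
open import Data.List.Base using (allFin)
open import Data.List.Extrema.Nat using (argmax; f[xs]≤f[argmax])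
open import Data.List.Membership.Propositional.Properties using (∈-allFin)
import Data.List.Relation.Unary.All as All
open import Data.Nat
open import Data.Nat.Properties
open import Data.Product using (∃; _×_; _,_)
open import Data.Sum using (_⊎_; inj₁; inj₂; [_,_]; swap)
open import Data.Sum.Function.Propositional using (_⊎-cong_)
open import Function using (_∘_; id; _⇔_; mk⇔; Equivalence)
open import Function.Construct.Composition using (_⇔-∘_)
open import Function.Construct.Symmetry using (⇔-sym)
open import Relation.Binary.Definitions using (tri<; tri≈; tri>)
open import Relation.Binary.PropositionalEquality
  using (_≡_; _≢_; refl; sym; trans; cong; subst; module ≡-Reasoning)
open import Relation.Nullary using (¬_; yes; no; contradiction)

open import Defs

pattern 3+ n = suc (suc (suc n))

⇔-inhabited : {A B : Set} → A → B → A ⇔ B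
⇔-inhabited a b = mk⇔ (λ _ → b) (λ _ → a)

⇔-uninhabited : {A B : Set} → ¬ A → ¬ B → A ⇔ B
⇔-uninhabited ¬a ¬b = mk⇔ (⊥-elim ∘ ¬a) (⊥-elim ∘ ¬b)

m≤n⇒m<n+1 : ∀ {m n} → m ≤ n → m < n + 1
m≤n⇒m<n+1 {n = n} m≤n = ≤-<-trans m≤n (m<m+n n z<s)

m<n+1⇒m≤n : ∀ {m n} → m < n + 1 → m ≤ n
m<n+1⇒m≤n {m} {n} m<n+1 = m<1+n⇒m≤n (subst (m <_) (+-comm n 1) m<n+1)

Consecutive : ℕ → ℕ → Set
Consecutive m n = suc m ≡ n ⊎ suc n ≡ m

consecutive⇒≢ : ∀ {m n} → Consecutive m n → m ≢ n
consecutive⇒≢ (inj₁ refl) = 1+n≢n ∘ sym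
consecutive⇒≢ (inj₂ refl) = 1+n≢n

consecutive⇔suc : ∀ {m n} → m < n → Consecutive m n ⇔ suc m ≡ n
consecutive⇔suc m<n = mk⇔ [ id , (λ { refl → contradiction m<n (<-asym (n<1+n _)) }) ] inj₁

argmax-Fin : ∀ {n} (f : Fin n → ℕ) → Fin n → ∃ λ x → ∀ y → f y ≤ f x
argmax-Fin {n} f x₀ =
  argmax f x₀ (allFin n) , λ y → All.lookup (f[xs]≤f[argmax] x₀ (allFin n)) (∈-allFin y)

∃-Fin⇔∃-< : ∀ {n} {P : ℕ → Set} → (∃ λ (z : Fin n) → P (toℕ z)) ⇔ (∃ λ z → z < n × P z)
∃-Fin⇔∃-< {P = P} = mk⇔ (λ (z , p) → toℕ z , toℕ<n z , p)
                        (λ (z , z<n , p) → fromℕ< z<n , subst P (sym (toℕ-fromℕ< z<n)) p)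

HasNeighbour : (G : Graph) → Fin (order G) → Set
HasNeighbour G x = ∃ λ y → x ≢ y × Edge G x y

NoIsolatedVertex : Graph → Set
NoIsolatedVertex G = ∀ x → HasNeighbour G x

maxLabel-isolated : ∀ {G ℓ} → IsSumLabelling G ℓ → ∀ x → (∀ z → ℓ z ≤ ℓ x) → ¬ HasNeighbour G x
maxLabel-isolated {ℓ = ℓ} (_ , positive , sum⇔) x max (y , x≢y , xy) =
  let (z , ℓz≡ℓx+ℓy) = Equivalence.to (sum⇔ x y x≢y) xy
  in <-irrefl refl (<-≤-trans (m<m+n (ℓ x) (positive y)) (subst (_≤ ℓ x) ℓz≡ℓx+ℓy (max z)))

noIsolatedVertex⇒¬sumGraph : ∀ G → NoIsolatedVertex G → Fin (order G) → ¬ IsSumGraph G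
noIsolatedVertex⇒¬sumGraph G noIsolated x₀ (ℓ , isSum) =
  let (x , max) = argmax-Fin ℓ x₀ in maxLabel-isolated isSum x max (noIsolated x)

data SplitView (m n : ℕ) : Fin (m + n) → Set where
  inl : (i : Fin m) → SplitView m n (i ↑ˡ n)
  inr : (j : Fin n) → SplitView m n (m ↑ʳ j)

splitView : ∀ m n (x : Fin (m + n)) → SplitView m n x
splitView zero    n x           = inr x
splitView (suc m) n Fin.zero    = inl Fin.zero
splitView (suc m) n (Fin.suc x) with splitView m n x
... | inl i = inl (Fin.suc i)
... | inr j = inr j

module _ (G H : Graph) where

  adj-↑ˡ-↑ˡ : ∀ i j → adj (G ⊕ H) (i ↑ˡ order H) (j ↑ˡ order H) ≡ adj G i j
  adj-↑ˡ-↑ˡ i j rewrite splitAt-↑ˡ (order G) i (order H) | splitAt-↑ˡ (order G) j (order H) = refl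

  adj-↑ʳ-↑ʳ : ∀ i j → adj (G ⊕ H) (order G ↑ʳ i) (order G ↑ʳ j) ≡ adj H i j
  adj-↑ʳ-↑ʳ i j rewrite splitAt-↑ʳ (order G) (order H) i | splitAt-↑ʳ (order G) (order H) j = refl

  adj-↑ˡ-↑ʳ : ∀ i j → adj (G ⊕ H) (i ↑ˡ order H) (order G ↑ʳ j) ≡ false
  adj-↑ˡ-↑ʳ i j rewrite splitAt-↑ˡ (order G) i (order H) | splitAt-↑ʳ (order G) (order H) j = refl

  adj-↑ʳ-↑ˡ : ∀ i j → adj (G ⊕ H) (order G ↑ʳ i) (j ↑ˡ order H) ≡ false
  adj-↑ʳ-↑ˡ i j rewrite splitAt-↑ʳ (order G) (order H) i | splitAt-↑ˡ (order G) j (order H) = refl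

  ⊕-noIsolatedVertex : NoIsolatedVertex G → NoIsolatedVertex H → NoIsolatedVertex (G ⊕ H)
  ⊕-noIsolatedVertex noG noH x with splitView (order G) (order H) x
  ... | inl i = let (j , i≢j , ij) = noG i
                in j ↑ˡ order H , i≢j ∘ ↑ˡ-injective _ i j , trans (adj-↑ˡ-↑ˡ i j) ij
  ... | inr i = let (j , i≢j , ij) = noH i
                in order G ↑ʳ j , i≢j ∘ ↑ʳ-injective _ i j , trans (adj-↑ʳ-↑ʳ i j) ij

P-edge⇔ : ∀ {k} (i j : Fin k) → Edge (P k) i j ⇔ Consecutive (toℕ i) (toℕ j)
P-edge⇔ i j = (≡ᵇ⇔≡ ⊎-cong ≡ᵇ⇔≡) ⇔-∘ (T-∨ ⇔-∘ ⇔-sym T-≡)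
  where
  ≡ᵇ⇔≡ : ∀ {m n} → T (m ≡ᵇ n) ⇔ m ≡ n
  ≡ᵇ⇔≡ = mk⇔ (≡ᵇ⇒≡ _ _) (≡⇒≡ᵇ _ _)

P-edge⇒C-edge : ∀ {n} (i j : Fin n) → Edge (P n) i j → Edge (C n) i j
P-edge⇒C-edge i j = widen (suc (toℕ i) ≡ᵇ toℕ j) (suc (toℕ j) ≡ᵇ toℕ i)
  where
  widen : ∀ x y {z} → x ∨ y ≡ true → x ∨ y ∨ z ≡ true
  widen true  _    _ = refl
  widen false true _ = refl

P-noIsolatedVertex : ∀ {k} → 2 ≤ k → NoIsolatedVertex (P k)
P-noIsolatedVertex {k} 2≤k i = neighbour (toℕ i) refl
  where
  neighbourAt : ∀ {b} (b<k : b < k) → Consecutive (toℕ i) b → HasNeighbour (P k) i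
  neighbourAt {b} b<k i~b rewrite sym (toℕ-fromℕ< b<k) =
    fromℕ< b<k , consecutive⇒≢ i~b ∘ cong toℕ , Equivalence.from (P-edge⇔ i (fromℕ< b<k)) i~b
  neighbour : ∀ a → toℕ i ≡ a → HasNeighbour (P k) i
  neighbour zero    i≡0   = neighbourAt 2≤k (inj₁ (cong suc i≡0))
  neighbour (suc a) i≡1+a = neighbourAt (<-trans (n<1+n a) (subst (_< k) i≡1+a (toℕ<n i))) (inj₂ (sym i≡1+a))

C-noIsolatedVertex : ∀ {n} → 2 ≤ n → NoIsolatedVertex (C n)
C-noIsolatedVertex 2≤n i = let (j , i≢j , ij) = P-noIsolatedVertex 2≤n i in j , i≢j , P-edge⇒C-edge i j ij

C₄⊕Pₖ-not-sumGraph : ∀ {k} → 2 ≤ k → ¬ IsSumGraph (C 4 ⊕ P k ⊕ N 0)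
C₄⊕Pₖ-not-sumGraph {k} 2≤k =
  noIsolatedVertex⇒¬sumGraph (C 4 ⊕ P k ⊕ N 0)
    (⊕-noIsolatedVertex (C 4 ⊕ P k) (N 0)
      (⊕-noIsolatedVertex (C 4) (P k) (C-noIsolatedVertex (s≤s (s≤s z≤n))) (P-noIsolatedVertex 2≤k))
      (λ ()))
    Fin.zero

u : ℕ → ℕ
u 0 = 1
u 1 = 3
u 2 = 4
u 3 = 9
u 4 = 11
u 5 = 12
u 6 = 16
u 7 = 20
u (2+ n) = u n + u (suc n)

u-rec : ∀ {n} → 6 ≤ n → u (2 + n) ≡ u n + u (1 + n)
u-rec 6≤n with m≤n⇒∃[o]m+o≡n 6≤n
... | _ , refl = refl

u-positive : ∀ n → 0 < u n
u-positive 0 = z<s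
u-positive 1 = z<s
u-positive 2 = z<s
u-positive 3 = z<s
u-positive 4 = z<s
u-positive 5 = z<s
u-positive 6 = z<s
u-positive 7 = z<s
u-positive (2+ n@(3+ (3+ _))) = <-≤-trans (u-positive n) (m≤m+n (u n) _)

u-<-suc : ∀ n → u n < u (suc n)
u-<-suc 0 = <ᵇ⇒< _ _ _
u-<-suc 1 = <ᵇ⇒< _ _ _
u-<-suc 2 = <ᵇ⇒< _ _ _
u-<-suc 3 = <ᵇ⇒< _ _ _
u-<-suc 4 = <ᵇ⇒< _ _ _
u-<-suc 5 = <ᵇ⇒< _ _ _
u-<-suc 6 = <ᵇ⇒< _ _ _
u-<-suc (suc n@(3+ (3+ _))) = m<n+m (u (suc n)) (u-positive n)

u-monotone : ∀ {m n} → m < n → u m < u n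
u-monotone {m} {suc n} m<1+n with m≤n⇒m<n∨m≡n (s≤s⁻¹ m<1+n)
... | inj₁ m<n  = <-trans (u-monotone m<n) (u-<-suc n)
... | inj₂ refl = u-<-suc m

u-monotone-≤ : ∀ {m n} → m ≤ n → u m ≤ u n
u-monotone-≤ m≤n with m≤n⇒m<n∨m≡n m≤n
... | inj₁ m<n  = <⇒≤ (u-monotone m<n)
... | inj₂ refl = ≤-refl

u-injective : ∀ {m n} → u m ≡ u n → m ≡ n
u-injective {m} {n} um≡un with <-cmp m n
... | tri< m<n _ _ = contradiction um≡un (<⇒≢ (u-monotone m<n))
... | tri≈ _ m≡n _ = m≡n
... | tri> _ _ n<m = contradiction (sym um≡un) (<⇒≢ (u-monotone n<m))

IsTerm : ℕ → Set
IsTerm s = ∃ λ n → u n ≡ s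

u-gap : ∀ n {s} → u n < s → s < u (suc n) → ¬ IsTerm s
u-gap n un<s s<un+1 (m , refl) with m ≤? n
... | yes m≤n = <⇒≱ un<s (u-monotone-≤ m≤n)
... | no  m≰n = <⇒≱ s<un+1 (u-monotone-≤ (≰⇒> m≰n))

u-gapᵇ : ∀ n {s} {_ : T (u n <ᵇ s)} {_ : T (s <ᵇ u (suc n))} → ¬ IsTerm s
u-gapᵇ n {s} {un<s} {s<un+1} = u-gap n (<ᵇ⇒< _ _ un<s) (<ᵇ⇒< _ _ s<un+1)

u-sum-not-term : ∀ {a n} → 6 ≤ n → a < n → ¬ IsTerm (u a + u (suc n))
u-sum-not-term {a} {n} 6≤n a<n = u-gap (suc n) (m<n+m (u (suc n)) (u-positive a)) sum<u[2+n]
  where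
  sum<u[2+n] : u a + u (suc n) < u (2 + n)
  sum<u[2+n] rewrite u-rec 6≤n = +-monoˡ-< (u (suc n)) (u-monotone a<n)

-- Vertices are numbered as in Fin (4 + k + 1): 0–3 around the cycle, 4, …, k + 3 along the
-- path, and k + 4 for the isolated vertex. Vertex m is labelled u (rank m).
rank : ℕ → ℕ
rank 2 = 3
rank 3 = 4
rank 4 = 5
rank 5 = 2
rank m = m

unrank : ℕ → ℕ
unrank 2 = 5
unrank 3 = 2
unrank 4 = 3
unrank 5 = 4
unrank m = m

unrank-rank : ∀ m → unrank (rank m) ≡ m
unrank-rank 0 = refl
unrank-rank 1 = refl
unrank-rank 2 = refl
unrank-rank 3 = refl
unrank-rank 4 = refl
unrank-rank 5 = refl
unrank-rank (3+ (3+ _)) = refl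

rank-fixed : ∀ {m} → 6 ≤ m → rank m ≡ m
rank-fixed 6≤m with m≤n⇒∃[o]m+o≡n 6≤m
... | _ , refl = refl

rank-< : ∀ {m n} → m < n → 6 ≤ n → rank m < n
rank-< {0} _ 6≤n = <-≤-trans (<ᵇ⇒< _ 6 _) 6≤n
rank-< {1} _ 6≤n = <-≤-trans (<ᵇ⇒< _ 6 _) 6≤n
rank-< {2} _ 6≤n = <-≤-trans (<ᵇ⇒< _ 6 _) 6≤n
rank-< {3} _ 6≤n = <-≤-trans (<ᵇ⇒< _ 6 _) 6≤n
rank-< {4} _ 6≤n = <-≤-trans (<ᵇ⇒< _ 6 _) 6≤n
rank-< {5} _ 6≤n = <-≤-trans (<ᵇ⇒< _ 6 _) 6≤n
rank-< {3+ (3+ _)} m<n _ = m<n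

label : ℕ → ℕ
label m = u (rank m)

label-injective : ∀ {m n} → label m ≡ label n → m ≡ n
label-injective {m} {n} eq = begin
  m                 ≡⟨ unrank-rank m ⟨
  unrank (rank m)   ≡⟨ cong unrank (u-injective {rank m} {rank n} eq) ⟩
  unrank (rank n)   ≡⟨ unrank-rank n ⟩
  n                 ∎
  where open ≡-Reasoning

label-path : ∀ i → label (4 + i) + label (5 + i) ≡ label (6 + i)
label-path 0      = refl
label-path 1      = refl
label-path (2+ _) = refl

label-≤ : ∀ {m n} → m ≤ n → 6 ≤ n → label m ≤ label n
label-≤ {m} {n} m≤n 6≤n rewrite rank-fixed 6≤n =
  u-monotone-≤ (s≤s⁻¹ (rank-< (s≤s m≤n) (m≤n⇒m≤1+n 6≤n)))

label-sum-not-term : ∀ {m n} → 6 ≤ n → m < n → ¬ IsTerm (label m + label (suc n))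
label-sum-not-term {m} {n} 6≤n m<n rewrite rank-fixed (m≤n⇒m≤1+n 6≤n) =
  u-sum-not-term 6≤n (rank-< m<n 6≤n)

cycle-path-not-term : ∀ (c : Fin 4) j → ¬ IsTerm (label (toℕ c) + label (4 + j))
cycle-path-not-term 0F 0 = u-gapᵇ 5
cycle-path-not-term 1F 0 = u-gapᵇ 5
cycle-path-not-term 2F 0 = u-gapᵇ 7
cycle-path-not-term 3F 0 = u-gapᵇ 7
cycle-path-not-term 0F 1 = u-gapᵇ 2
cycle-path-not-term 1F 1 = u-gapᵇ 2
cycle-path-not-term 2F 1 = u-gapᵇ 5
cycle-path-not-term 3F 1 = u-gapᵇ 5
cycle-path-not-term 0F 2 = u-gapᵇ 6
cycle-path-not-term 1F 2 = u-gapᵇ 6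
cycle-path-not-term 2F 2 = u-gapᵇ 7
cycle-path-not-term 3F 2 = u-gapᵇ 7
cycle-path-not-term c (3+ j) = label-sum-not-term (m≤m+n 6 j) (<-≤-trans (toℕ<n c) (m≤m+n 4 (2 + j)))

distant-path-not-term : ∀ {a b} → 2 + a ≤ b → ¬ IsTerm (label (4 + a) + label (4 + b))
distant-path-not-term {0}     {2}    _        = u-gapᵇ 7
distant-path-not-term {a}     {3+ b} 2+a≤3+b = label-sum-not-term (m≤m+n 6 b) (+-monoʳ-≤ 3 2+a≤3+b)
distant-path-not-term {suc _} {2}    (s≤s (s≤s ()))
distant-path-not-term {b = 1} (s≤s ())

IsVertexLabel : ℕ → ℕ → Set
IsVertexLabel k s = ∃ λ z → z < 4 + k + 1 × label z ≡ s

vertexLabel⇒term : ∀ {k s} → IsVertexLabel k s → IsTerm s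
vertexLabel⇒term (z , _ , eq) = rank z , eq

cycle-edge⇔ : ∀ {k} → 3 ≤ k → (c d : Fin 4) → c ≢ d →
              Edge (C 4) c d ⇔ IsVertexLabel k (label (toℕ c) + label (toℕ d))
cycle-edge⇔ {k} 3≤k = λ where
    0F 1F _ → edgeAt 5 refl
    1F 0F _ → edgeAt 5 refl
    1F 2F _ → edgeAt 4 refl
    2F 1F _ → edgeAt 4 refl
    2F 3F _ → edgeAt 7 refl
    3F 2F _ → edgeAt 7 refl
    3F 0F _ → edgeAt 4 refl
    0F 3F _ → edgeAt 4 refl
    0F 2F _ → ⇔-uninhabited (λ ()) (u-gapᵇ 3 ∘ vertexLabel⇒term)
    2F 0F _ → ⇔-uninhabited (λ ()) (u-gapᵇ 3 ∘ vertexLabel⇒term)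
    1F 3F _ → ⇔-uninhabited (λ ()) (u-gapᵇ 5 ∘ vertexLabel⇒term)
    3F 1F _ → ⇔-uninhabited (λ ()) (u-gapᵇ 5 ∘ vertexLabel⇒term)
    0F 0F c≢c → contradiction refl c≢c
    1F 1F c≢c → contradiction refl c≢c
    2F 2F c≢c → contradiction refl c≢c
    3F 3F c≢c → contradiction refl c≢c
  where
  edgeAt : ∀ z {s} {_ : T (z ≤ᵇ 7)} → label z ≡ s → true ≡ true ⇔ IsVertexLabel k s
  edgeAt z {_} {z≤7} eq =
    ⇔-inhabited refl (z , m≤n⇒m<n+1 (≤-trans (≤ᵇ⇒≤ z 7 z≤7) (+-monoʳ-≤ 4 3≤k)) , eq)

path-edge⇔-< : ∀ {k a b} → a < b → b < k →
               suc a ≡ b ⇔ IsVertexLabel k (label (4 + a) + label (4 + b))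
path-edge⇔-< {k} {a} {b} a<b b<k = mk⇔ to from
  where
  to : suc a ≡ b → IsVertexLabel k (label (4 + a) + label (4 + b))
  to refl = 6 + a , m≤n⇒m<n+1 (+-monoʳ-≤ 4 b<k) , sym (label-path a)
  from : IsVertexLabel k (label (4 + a) + label (4 + b)) → suc a ≡ b
  from isLabel with m≤n⇒m<n∨m≡n a<b
  ... | inj₁ 2+a≤b = contradiction (vertexLabel⇒term isLabel) (distant-path-not-term 2+a≤b)
  ... | inj₂ 1+a≡b = 1+a≡b

path-edge⇔ : ∀ {k} (i j : Fin k) → i ≢ j →
             Edge (P k) i j ⇔ IsVertexLabel k (label (4 + toℕ i) + label (4 + toℕ j))
path-edge⇔ {k} i j i≢j = sums (toℕ<n i) (toℕ<n j) (i≢j ∘ toℕ-injective) ⇔-∘ P-edge⇔ i j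
  where
  sums : ∀ {a b} → a < k → b < k → a ≢ b →
         Consecutive a b ⇔ IsVertexLabel k (label (4 + a) + label (4 + b))
  sums {a} {b} a<k b<k a≢b with <-cmp a b
  ... | tri< a<b _ _ = path-edge⇔-< a<b b<k ⇔-∘ consecutive⇔suc a<b
  ... | tri≈ _ a≡b _ = contradiction a≡b a≢b
  ... | tri> _ _ b<a rewrite +-comm (label (4 + a)) (label (4 + b)) =
    path-edge⇔-< b<a a<k ⇔-∘ (consecutive⇔suc b<a ⇔-∘ mk⇔ swap swap)

C₄⊕Pₖ-edge⇔ : ∀ {k} → 3 ≤ k → (x y : Fin (4 + k)) → x ≢ y →
              Edge (C 4 ⊕ P k) x y ⇔ IsVertexLabel k (label (toℕ x) + label (toℕ y))
C₄⊕Pₖ-edge⇔ {k} 3≤k x y x≢y with splitView 4 k x | splitView 4 k y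
... | inl c | inl d rewrite adj-↑ˡ-↑ˡ (C 4) (P k) c d | toℕ-↑ˡ c k | toℕ-↑ˡ d k =
  cycle-edge⇔ 3≤k c d (x≢y ∘ cong (_↑ˡ k))
... | inr i | inr j rewrite adj-↑ʳ-↑ʳ (C 4) (P k) i j | toℕ-↑ʳ 4 i | toℕ-↑ʳ 4 j =
  path-edge⇔ i j (x≢y ∘ cong (4 ↑ʳ_))
... | inl c | inr j rewrite adj-↑ˡ-↑ʳ (C 4) (P k) c j | toℕ-↑ˡ c k | toℕ-↑ʳ 4 j =
  ⇔-uninhabited (λ ()) (cycle-path-not-term c (toℕ j) ∘ vertexLabel⇒term)
... | inr i | inl d rewrite adj-↑ʳ-↑ˡ (C 4) (P k) i d | toℕ-↑ʳ 4 i | toℕ-↑ˡ d k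
                          | +-comm (label (4 + toℕ i)) (label (toℕ d)) =
  ⇔-uninhabited (λ ()) (cycle-path-not-term d (toℕ i) ∘ vertexLabel⇒term)

isolated-sum-not-vertexLabel : ∀ {k} → 3 ≤ k → ∀ m → ¬ IsVertexLabel k (label (4 + k) + label m)
isolated-sum-not-vertexLabel {k} 3≤k m (z , z<n , lz≡) =
  <⇒≱ (m<m+n (label (4 + k)) (u-positive (rank m)))
      (subst (_≤ label (4 + k)) lz≡ (label-≤ (m<n+1⇒m≤n z<n) (+-monoʳ-≤ 4 (≤-trans (n≤1+n 2) 3≤k))))

label-isolated : ∀ {k} (o : Fin 1) → label (toℕ ((4 + k) ↑ʳ o)) ≡ label (4 + k)
label-isolated {k} 0F = cong label (trans (toℕ-↑ʳ (4 + k) 0F) (+-identityʳ (4 + k)))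

C₄⊕Pₖ⊕N₁-edge⇔ : ∀ {k} → 3 ≤ k → (x y : Fin (4 + k + 1)) → x ≢ y →
                 Edge (C 4 ⊕ P k ⊕ N 1) x y ⇔ IsVertexLabel k (label (toℕ x) + label (toℕ y))
C₄⊕Pₖ⊕N₁-edge⇔ {k} 3≤k x y x≢y with splitView (4 + k) 1 x | splitView (4 + k) 1 y
... | inl v | inl w rewrite adj-↑ˡ-↑ˡ (C 4 ⊕ P k) (N 1) v w | toℕ-↑ˡ v 1 | toℕ-↑ˡ w 1 =
  C₄⊕Pₖ-edge⇔ 3≤k v w (x≢y ∘ cong (_↑ˡ 1))
... | inl v | inr o rewrite adj-↑ˡ-↑ʳ (C 4 ⊕ P k) (N 1) v o | toℕ-↑ˡ v 1
                          | label-isolated {k} o | +-comm (label (toℕ v)) (label (4 + k)) =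
  ⇔-uninhabited (λ ()) (isolated-sum-not-vertexLabel 3≤k (toℕ v))
... | inr o | inl w rewrite adj-↑ʳ-↑ˡ (C 4 ⊕ P k) (N 1) o w | toℕ-↑ˡ w 1 | label-isolated {k} o =
  ⇔-uninhabited (λ ()) (isolated-sum-not-vertexLabel 3≤k (toℕ w))
... | inr 0F | inr 0F = contradiction refl x≢y

C₄⊕Pₖ⊕N₁-sumLabelling : ∀ {k} → 3 ≤ k → IsSumLabelling (C 4 ⊕ P k ⊕ N 1) (label ∘ toℕ)
C₄⊕Pₖ⊕N₁-sumLabelling 3≤k =
  toℕ-injective ∘ label-injective ,
  (λ x → u-positive (rank (toℕ x))) ,
  (λ x y x≢y → ⇔-sym ∃-Fin⇔∃-< ⇔-∘ C₄⊕Pₖ⊕N₁-edge⇔ 3≤k x y x≢y)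

lemma19 : ∀ (k : ℕ) → 3 ≤ k → SumNumber (C 4 ⊕ P k) 1
lemma19 k 3≤k = (label ∘ toℕ , C₄⊕Pₖ⊕N₁-sumLabelling 3≤k) , fewer
  where
  fewer : ∀ j → j < 1 → ¬ IsSumGraph (C 4 ⊕ P k ⊕ N j)
  fewer 0       _        = C₄⊕Pₖ-not-sumGraph (≤-trans (n≤1+n 2) 3≤k)
  fewer (suc _) (s≤s ())
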